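{- Let $G$ and $H$ be bipartite graphs all of whose connected components have at least two vertices, and suppose there is a bijection $\beta$ from the set of connected components of $G$ to the set of connected components of $H$ such that each component $C$ of $G$ has the same size parameter as $\beta(C)$. Then $|\mathrm{Hom}(G,T)| = |\mathrm{Hom}(H,T)|$ for every tree $T$ of diameter at most $2$.
   Context: All graphs are finite, simple and undirected. $\mathrm{Hom}(G,H)$ is the set of homomorphisms from $G$ to $H$. A tree is a connected acyclic graph; the diameter is the maximum over pairs of distinct vertices of the length of a shortest path between them. The size parameter of a connected bipartite graph with at least two vertices is the pair $(m,n)$ of positive integers with $m\le n$ such that the two parts of its bipartition have $m$ and $n$ vertices respectively. -}

module Defs where

open import Data.Nat using (ℕ; zero; suc; _≤_; _<_)
open import Data.Bool using (Bool; true; false)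
import Data.Bool as Bool
open import Data.Fin using (Fin; zero; suc; inject₁; fromℕ)
open import Data.Fin.Properties using (all?)
import Data.Fin as Fin
open import Data.Vec using (Vec; []; _∷_; lookup)
open import Data.List using (List; []; _∷_; [_]; length; filter; allFin; concatMap; map)
open import Data.Product using (Σ; ∃; ∃-syntax; _×_; _,_)
open import Data.Sum using (_⊎_)
open import Relation.Nullary using (¬_; Dec)
open import Relation.Nullary.Decidable using (_→-dec_; _×-dec_)
open import Relation.Binary.PropositionalEquality using (_≡_; _≢_)
open import Relation.Binary.Construct.Closure.ReflexiveTransitive using (Star)
open import Function using (Injective; _↔_)

record Graph : Set where
  field
    V      : ℕ
    adj    : Fin V → Fin V → Bool
    sym    : ∀ u v → adj u v ≡ adj v u
    irrefl : ∀ v → adj v v ≡ false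
open Graph public

Adj : (G : Graph) → Fin (V G) → Fin (V G) → Set
Adj G u v = adj G u v ≡ true

Reachable : (G : Graph) → Fin (V G) → Fin (V G) → Set
Reachable G = Star (Adj G)

IsHom : (G T : Graph) → Vec (Fin (V T)) (V G) → Set
IsHom G T f = ∀ u v → Adj G u v → Adj T (lookup f u) (lookup f v)

isHom? : (G T : Graph) → (f : Vec (Fin (V T)) (V G)) → Dec (IsHom G T f)
isHom? G T f = all? λ u → all? λ v →
  (adj G u v Bool.≟ true) →-dec (adj T (lookup f u) (lookup f v) Bool.≟ true)

allVecs : (n m : ℕ) → List (Vec (Fin m) n)
allVecs zero    m = [ [] ]
allVecs (suc n) m = concatMap (λ x → map (x ∷_) (allVecs n m)) (allFin m)

homCount : (G T : Graph) → ℕ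
homCount G T = length (filter (isHom? G T) (allVecs (V G) (V T)))

ProperColouring : (G : Graph) → (Fin (V G) → Bool) → Set
ProperColouring G col = ∀ u v → Adj G u v → col u ≢ col v

Bipartite : Graph → Set
Bipartite G = ∃[ col ] ProperColouring G col

-- c labels the connected components of G by Fin k: every label is used
-- and two vertices get the same label iff they lie in the same component.
-- (The set of components of G is thus identified with Fin k.)
record ComponentLabelling (G : Graph) (k : ℕ) : Set where
  field
    label    : Fin (V G) → Fin k
    surj     : ∀ i → ∃[ v ] label v ≡ i
    sameComp : ∀ u v → (label u ≡ label v → Reachable G u v)
                     × (Reachable G u v → label u ≡ label v)
open ComponentLabelling public

ComponentsNontrivial : (G : Graph) {k : ℕ} → ComponentLabelling G k → Set
ComponentsNontrivial G c =
  ∀ i → ∃[ u ] ∃[ v ] (u ≢ v × label c u ≡ i × label c v ≡ i)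

colourCount : (G : Graph) {k : ℕ} → ComponentLabelling G k →
              (Fin (V G) → Bool) → Fin k → Bool → ℕ
colourCount G c col i b =
  length (filter (λ v → (label c v Fin.≟ i) ×-dec (col v Bool.≟ b)) (allFin (V G)))

HasSizeParam : (G : Graph) {k : ℕ} → ComponentLabelling G k → Fin k → ℕ → ℕ → Set
HasSizeParam G c i m n =
  m ≤ n × ∃[ col ] (ProperColouring G col ×
    ((colourCount G c col i false ≡ m × colourCount G c col i true ≡ n)
     ⊎ (colourCount G c col i false ≡ n × colourCount G c col i true ≡ m)))

Connected : Graph → Set
Connected G = ∀ u v → Reachable G u v

-- a cycle of length l+3: distinct vertices f 0, …, f (l+2), consecutive ones
-- adjacent, and f (l+2) adjacent to f 0
record Cycle (G : Graph) : Set where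
  field
    l     : ℕ
    f     : Fin (suc (suc (suc l))) → Fin (V G)
    inj   : Injective _≡_ _≡_ f
    step  : ∀ (i : Fin (suc (suc l))) → Adj G (f (inject₁ i)) (f (suc i))
    close : Adj G (f (fromℕ (suc (suc l)))) (f zero)

Acyclic : Graph → Set
Acyclic G = ¬ Cycle G

IsTree : Graph → Set
IsTree G = (0 < V G) × Connected G × Acyclic G

DiameterAtMost2 : Graph → Set
DiameterAtMost2 G = ∀ u v → u ≢ v → Adj G u v ⊎ (∃[ w ] (Adj G u w × Adj G w v))

{-# OPTIONS --safe #-}

-- A tree of diameter at most 2 is a star, hence a complete bipartite graph K_{a,b} whose two parts
-- are cut out by a Boolean `side`. Fix a proper 2-colouring col of G. A map f into K_{a,b} is a
-- homomorphism iff side (f v) xor col v is constant on every component, so summing over the 2^k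
-- possible constants factorises |Hom(G, K_{a,b})| as the product over the components of
-- a^p b^q + b^p a^q, where p and q are the sizes of the colour classes. Each factor depends only on
-- the size parameter of its component, so the products for G and H agree after reindexing along β.

module Submission where

open import Defs hiding (sym)
open import Algebra.Properties.CommutativeSemigroup using (interchange)
import Algebra.Properties.CommutativeMonoid.Sum as CommutativeMonoidSum
open import Data.Bool using (Bool; true; false; _xor_; if_then_else_)
import Data.Bool.Properties as Bool
open import Data.Fin using (Fin; zero; suc; inject₁; fromℕ; fromℕ<; punchIn; _≟_)
open import Data.Fin.Properties using (all?; any?; ¬∀⟶∃¬; punchInᵢ≢i)
import Data.Fin.Permutation as Permutation
open import Data.List using (List; []; _∷_; [_]; _++_; length; filter; allFin; concatMap; map; tabulate)
open import Data.List.Properties using (map-++; map-cong; map-∘; filter-≐)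
open import Data.Nat using (ℕ; zero; suc; _+_; _*_; _^_)
open import Data.Nat.ListAction using (sum)
open import Data.Nat.ListAction.Properties using (sum-++)
open import Data.Nat.Properties
  using (+-identityʳ; *-identityʳ; *-identityˡ; *-zeroʳ; +-comm; *-comm; *-distribˡ-+; *-distribʳ-+;
         ^-distribˡ-+-*; [m*n]*[o*p]≡[m*o]*[n*p];
         +-0-commutativeMonoid; *-1-commutativeMonoid; +-commutativeSemigroup)
open import Data.Product using (∃-syntax; _×_; _,_; proj₁; proj₂)
open import Data.Sum using (_⊎_; inj₁; inj₂)
open import Data.Empty using (⊥; ⊥-elim)
open import Data.Vec using (Vec; []; _∷_; lookup)
open import Data.Vec.Relation.Unary.AllPairs using ([]; _∷_)
open import Data.Vec.Relation.Unary.All using ([]; _∷_)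
open import Data.Vec.Relation.Unary.Linked using (Linked; [-]; _∷_)
open import Data.Vec.Relation.Unary.Unique.Propositional using (Unique)
open import Data.Vec.Relation.Unary.Unique.Propositional.Properties using (lookup-injective)
open import Function using (_∘_; _↔_; Inverse; _⇔_; mk⇔; Equivalence)
open import Relation.Binary.Construct.Closure.ReflexiveTransitive using (ε; _◅_)
open import Relation.Binary.PropositionalEquality
  using (_≡_; _≢_; refl; sym; trans; cong; cong₂; subst; ≢-sym; module ≡-Reasoning)
open import Relation.Nullary using (¬_; Dec; yes; no; does; contradiction)
open import Relation.Nullary.Decidable using (_×-dec_; ¬?; isYes; decidable-stable)

open CommutativeMonoidSum +-0-commutativeMonoid using (sum-syntax)
-- Products are sums in the multiplicative monoid: ∏.∑-distrib-+ reads ∏ (f * g) ≡ ∏ f * ∏ g.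
module ∏ = CommutativeMonoidSum *-1-commutativeMonoid

∏ : ∀ {n} → (Fin n → ℕ) → ℕ
∏ = ∏.sum

𝟙 : ∀ {p} {P : Set p} → Dec P → ℕ
𝟙 d = if does d then 1 else 0

𝟙-yes : ∀ {p} {P : Set p} (d : Dec P) → P → 𝟙 d ≡ 1
𝟙-yes (yes _) _ = refl
𝟙-yes (no ¬p) p = contradiction p ¬p

𝟙-no : ∀ {p} {P : Set p} (d : Dec P) → ¬ P → 𝟙 d ≡ 0
𝟙-no (yes p) ¬p = contradiction p ¬p
𝟙-no (no _) _ = refl

module _ {p q} {P : Set p} {Q : Set q} where

  𝟙-cong : (d : Dec P) (e : Dec Q) → P ⇔ Q → 𝟙 d ≡ 𝟙 e
  𝟙-cong (yes p) e P⇔Q = sym (𝟙-yes e (Equivalence.to P⇔Q p))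
  𝟙-cong (no ¬p) e P⇔Q = sym (𝟙-no e (¬p ∘ Equivalence.from P⇔Q))

  𝟙-× : (d : Dec P) (e : Dec Q) → 𝟙 (d ×-dec e) ≡ 𝟙 d * 𝟙 e
  𝟙-× (yes _) (yes _) = refl
  𝟙-× (yes _) (no _) = refl
  𝟙-× (no _) e = refl

sumOver : ∀ {a} {A : Set a} → List A → (A → ℕ) → ℕ
sumOver xs h = sum (map h xs)

module _ {a} {A : Set a} where

  length-filter≡sumOver-𝟙 : ∀ {p} {P : A → Set p} (P? : ∀ x → Dec (P x)) xs →
                            length (filter P? xs) ≡ sumOver xs (λ x → 𝟙 (P? x))
  length-filter≡sumOver-𝟙 P? [] = refl
  length-filter≡sumOver-𝟙 P? (x ∷ xs) with does (P? x)
  ... | true  = cong suc (length-filter≡sumOver-𝟙 P? xs)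
  ... | false = length-filter≡sumOver-𝟙 P? xs

  sumOver-cong : ∀ xs {h h′ : A → ℕ} → (∀ x → h x ≡ h′ x) → sumOver xs h ≡ sumOver xs h′
  sumOver-cong xs h≗h′ = cong sum (map-cong h≗h′ xs)

  sumOver-zero : ∀ (xs : List A) → sumOver xs (λ _ → 0) ≡ 0
  sumOver-zero [] = refl
  sumOver-zero (x ∷ xs) = sumOver-zero xs

  sumOver-+ : ∀ xs (h h′ : A → ℕ) → sumOver xs (λ x → h x + h′ x) ≡ sumOver xs h + sumOver xs h′
  sumOver-+ [] h h′ = refl
  sumOver-+ (x ∷ xs) h h′ = trans (cong (h x + h′ x +_) (sumOver-+ xs h h′))
                                  (interchange +-commutativeSemigroup (h x) (h′ x) _ _)

  *-distribˡ-sumOver : ∀ m xs (h : A → ℕ) → m * sumOver xs h ≡ sumOver xs (λ x → m * h x)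
  *-distribˡ-sumOver m [] h = *-zeroʳ m
  *-distribˡ-sumOver m (x ∷ xs) h = trans (*-distribˡ-+ m (h x) _) (cong (m * h x +_) (*-distribˡ-sumOver m xs h))

  *-distribʳ-sumOver : ∀ m xs (h : A → ℕ) → sumOver xs h * m ≡ sumOver xs (λ x → h x * m)
  *-distribʳ-sumOver m [] h = refl
  *-distribʳ-sumOver m (x ∷ xs) h = trans (*-distribʳ-+ m (h x) _) (cong (h x * m +_) (*-distribʳ-sumOver m xs h))

  sumOver-comm : ∀ {b} {B : Set b} (xs : List B) ys (h : B → A → ℕ) →
                 sumOver xs (λ x → sumOver ys (h x)) ≡ sumOver ys (λ y → sumOver xs (λ x → h x y))
  sumOver-comm [] ys h = sym (sumOver-zero ys)
  sumOver-comm (x ∷ xs) ys h = trans (cong (sumOver ys (h x) +_) (sumOver-comm xs ys h))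
                                     (sym (sumOver-+ ys (h x) _))

  sumOver-map : ∀ {b} {B : Set b} (g : B → A) xs (h : A → ℕ) → sumOver (map g xs) h ≡ sumOver xs (h ∘ g)
  sumOver-map g xs h = cong sum (sym (map-∘ xs))

  sumOver-concatMap : ∀ {b} {B : Set b} (g : B → List A) xs (h : A → ℕ) →
                      sumOver (concatMap g xs) h ≡ sumOver xs (λ x → sumOver (g x) h)
  sumOver-concatMap g [] h = refl
  sumOver-concatMap g (x ∷ xs) h = begin
    sum (map h (g x ++ concatMap g xs))  ≡⟨ cong sum (map-++ h (g x) _) ⟩
    sum (map h (g x) ++ map h (concatMap g xs)) ≡⟨ sum-++ (map h (g x)) _ ⟩
    sumOver (g x) h + sumOver (concatMap g xs) h  ≡⟨ cong (sumOver (g x) h +_) (sumOver-concatMap g xs h) ⟩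
    sumOver (g x) h + sumOver xs (λ x → sumOver (g x) h) ∎
    where open ≡-Reasoning

sumOver-tabulate : ∀ {a} {A : Set a} {n} (f : Fin n → A) (h : A → ℕ) →
                   sumOver (tabulate f) h ≡ ∑[ i < n ] h (f i)
sumOver-tabulate {n = zero} f h = refl
sumOver-tabulate {n = suc n} f h = cong (h (f zero) +_) (sumOver-tabulate (f ∘ suc) h)

vecsOver : ∀ {a} {A : Set a} → List A → (n : ℕ) → List (Vec A n)
vecsOver xs zero    = [ [] ]
vecsOver xs (suc n) = concatMap (λ x → map (x ∷_) (vecsOver xs n)) xs

allVecs≡vecsOver-allFin : ∀ n m → allVecs n m ≡ vecsOver (allFin m) n
allVecs≡vecsOver-allFin zero    m = refl
allVecs≡vecsOver-allFin (suc n) m =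
  cong (λ fs → concatMap (λ x → map (x ∷_) fs) (allFin m)) (allVecs≡vecsOver-allFin n m)

sumOver-vecsOver-∏ : ∀ {a} {A : Set a} (xs : List A) n (h : Fin n → A → ℕ) →
  sumOver (vecsOver xs n) (λ f → ∏ (λ v → h v (lookup f v))) ≡ ∏ (λ v → sumOver xs (h v))
sumOver-vecsOver-∏ xs zero    h = refl
sumOver-vecsOver-∏ xs (suc n) h = begin
  sumOver (concatMap (λ x → map (x ∷_) (vecsOver xs n)) xs) term
    ≡⟨ sumOver-concatMap (λ x → map (x ∷_) (vecsOver xs n)) xs term ⟩
  sumOver xs (λ x → sumOver (map (x ∷_) (vecsOver xs n)) term)
    ≡⟨ sumOver-cong xs (λ x → sumOver-map (x ∷_) (vecsOver xs n) term) ⟩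
  sumOver xs (λ x → sumOver (vecsOver xs n) (λ f → h zero x * rest f))
    ≡⟨ sumOver-cong xs (λ x → sym (*-distribˡ-sumOver (h zero x) (vecsOver xs n) rest)) ⟩
  sumOver xs (λ x → h zero x * sumOver (vecsOver xs n) rest)
    ≡⟨ sumOver-cong xs (λ x → cong (h zero x *_) (sumOver-vecsOver-∏ xs n (h ∘ suc))) ⟩
  sumOver xs (λ x → h zero x * ∏ (λ v → sumOver xs (h (suc v))))
    ≡⟨ sym (*-distribʳ-sumOver _ xs (h zero)) ⟩
  sumOver xs (h zero) * ∏ (λ v → sumOver xs (h (suc v))) ∎
  where
  open ≡-Reasoning
  term : Vec _ (suc n) → ℕ
  term f = ∏ (λ v → h v (lookup f v))
  rest : Vec _ n → ℕ
  rest f = ∏ (λ v → h (suc v) (lookup f v))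

∏-point : ∀ {n} (h : Fin n → ℕ) j → (∀ i → i ≢ j → h i ≡ 1) → ∏ h ≡ h j
∏-point {suc n} h j off = begin
  ∏ h                      ≡⟨ ∏.sum-remove {i = j} h ⟩
  h j * ∏ (h ∘ punchIn j)  ≡⟨ cong (h j *_) (∏.sum-cong-≗ (λ i → off (punchIn j i) (punchInᵢ≢i j i))) ⟩
  h j * ∏ {n} (λ _ → 1)    ≡⟨ cong (h j *_) (∏.sum-replicate-zero n) ⟩
  h j * 1                  ≡⟨ *-identityʳ (h j) ⟩
  h j                      ∎
  where open ≡-Reasoning

∏-zero : ∀ {n} (h : Fin n → ℕ) j → h j ≡ 0 → ∏ h ≡ 0
∏-zero {suc n} h j hj≡0 = trans (∏.sum-remove {i = j} h) (cong (_* ∏ (h ∘ punchIn j)) hj≡0)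

∏-𝟙 : ∀ {n p} {P : Fin n → Set p} (P? : ∀ i → Dec (P i)) (all : Dec (∀ i → P i)) →
      ∏ (λ i → 𝟙 (P? i)) ≡ 𝟙 all
∏-𝟙 {n} P? (yes all) = trans (∏.sum-cong-≗ (λ i → 𝟙-yes (P? i) (all i))) (∏.sum-replicate-zero n)
∏-𝟙 {n} {P = P} P? (no ¬all) with ¬∀⟶∃¬ n P P? ¬all
... | j , ¬Pj = ∏-zero _ j (𝟙-no (P? j) ¬Pj)

fibreSize : ∀ {n k} → (Fin n → Fin k) → (Fin n → Bool) → Fin k → Bool → ℕ
fibreSize {n} g b i c = ∑[ v < n ] 𝟙 ((g v ≟ i) ×-dec (b v Bool.≟ c))

module _ {k} (F : Fin k → Bool → ℕ) where

  private
    powers : (Fin k → Bool → ℕ) → Fin k → ℕ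
    powers e i = F i false ^ e i false * F i true ^ e i true

    at : (j : Fin k) (c : Bool) (i : Fin k) (c′ : Bool) → Dec ((j ≡ i) × (c ≡ c′))
    at j c i c′ = (j ≟ i) ×-dec (c Bool.≟ c′)

    ∏-powers-point : ∀ j c → F j c ≡ ∏ (powers (λ i c′ → 𝟙 (at j c i c′)))
    ∏-powers-point j c = sym (trans (∏-point _ j off) (on-diagonal c))
      where
      off : ∀ i → i ≢ j → powers (λ i c′ → 𝟙 (at j c i c′)) i ≡ 1
      off i i≢j = cong₂ (λ x y → F i false ^ x * F i true ^ y)
                        (𝟙-no (at j c i false) (i≢j ∘ sym ∘ proj₁))
                        (𝟙-no (at j c i true) (i≢j ∘ sym ∘ proj₁))
      on-diagonal : ∀ c → powers (λ i c′ → 𝟙 (at j c i c′)) j ≡ F j c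
      on-diagonal false = trans (cong₂ (λ x y → F j false ^ x * F j true ^ y)
                                       (𝟙-yes (at j false j false) (refl , refl))
                                       (𝟙-no (at j false j true) (λ ())))
                                (trans (*-identityʳ _) (*-identityʳ _))
      on-diagonal true  = trans (cong₂ (λ x y → F j false ^ x * F j true ^ y)
                                       (𝟙-no (at j true j false) (λ ()))
                                       (𝟙-yes (at j true j true) (refl , refl)))
                                (trans (*-identityˡ _) (*-identityʳ _))

  ∏-group : ∀ {n} (g : Fin n → Fin k) (b : Fin n → Bool) →
            ∏ (λ v → F (g v) (b v)) ≡
            ∏ (λ i → F i false ^ fibreSize g b i false * F i true ^ fibreSize g b i true)
  ∏-group {zero} g b = sym (∏.sum-replicate-zero k)
  ∏-group {suc n} g b = begin
    F (g zero) (b zero) * ∏ (λ v → F (g (suc v)) (b (suc v)))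
      ≡⟨ cong₂ _*_ (∏-powers-point (g zero) (b zero)) (∏-group (g ∘ suc) (b ∘ suc)) ⟩
    ∏ (powers first) * ∏ (powers rest)
      ≡⟨ sym (∏.∑-distrib-+ (powers first) (powers rest)) ⟩
    ∏ (λ i → powers first i * powers rest i)
      ≡⟨ ∏.sum-cong-≗ (λ i → powers-+ (F i false) (F i true)
                                      (first i false) (first i true) (rest i false) (rest i true)) ⟩
    ∏ (powers (fibreSize g b)) ∎
    where
    open ≡-Reasoning
    first : Fin k → Bool → ℕ
    first i c = 𝟙 (at (g zero) (b zero) i c)
    rest : Fin k → Bool → ℕ
    rest = fibreSize (g ∘ suc) (b ∘ suc)
    powers-+ : ∀ x y p q r s → (x ^ p * y ^ q) * (x ^ r * y ^ s) ≡ x ^ (p + r) * y ^ (q + s)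
    powers-+ x y p q r s = trans ([m*n]*[o*p]≡[m*o]*[n*p] (x ^ p) (y ^ q) (x ^ r) (y ^ s))
                                 (sym (cong₂ _*_ (^-distribˡ-+-* x p r) (^-distribˡ-+-* y q s)))

bools : List Bool
bools = true ∷ false ∷ []

sumOver-vecsOver-bools-𝟙-agree : ∀ {k} (τ : Fin k → Bool) →
  sumOver (vecsOver bools k) (λ σ → 𝟙 (all? (λ i → lookup σ i Bool.≟ τ i))) ≡ 1
sumOver-vecsOver-bools-𝟙-agree {k} τ = begin
  sumOver (vecsOver bools k) (λ σ → 𝟙 (all? (λ i → lookup σ i Bool.≟ τ i)))
    ≡⟨ sumOver-cong (vecsOver bools k) (λ σ → sym (∏-𝟙 (λ i → lookup σ i Bool.≟ τ i) (all? _))) ⟩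
  sumOver (vecsOver bools k) (λ σ → ∏ (λ i → 𝟙 (lookup σ i Bool.≟ τ i)))
    ≡⟨ sumOver-vecsOver-∏ bools k (λ i b → 𝟙 (b Bool.≟ τ i)) ⟩
  ∏ (λ i → sumOver bools (λ b → 𝟙 (b Bool.≟ τ i)))
    ≡⟨ ∏.sum-cong-≗ (λ i → one-agreeing-bool (τ i)) ⟩
  ∏ {k} (λ _ → 1)
    ≡⟨ ∏.sum-replicate-zero k ⟩
  1 ∎
  where
  open ≡-Reasoning
  one-agreeing-bool : ∀ c → sumOver bools (λ b → 𝟙 (b Bool.≟ c)) ≡ 1
  one-agreeing-bool true  = refl
  one-agreeing-bool false = refl

xor-≢ : ∀ {a b c d} → a ≢ b → c ≢ d → a xor c ≡ b xor d
xor-≢ {b = b} {d = d} a≢b c≢d =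
  trans (cong₂ _xor_ (Bool.¬-not a≢b) (Bool.¬-not c≢d)) (Bool.xor-annihilates-not b d)

xor-cancelˡ : ∀ a {c d} → a xor c ≡ a xor d → c ≡ d
xor-cancelˡ a {c} {d} eq = begin
  c                ≡⟨ cong (_xor c) (Bool.xor-same a) ⟨
  (a xor a) xor c  ≡⟨ Bool.xor-assoc a a c ⟩
  a xor (a xor c)  ≡⟨ cong (a xor_) eq ⟩
  a xor (a xor d)  ≡⟨ Bool.xor-assoc a a d ⟨
  (a xor a) xor d  ≡⟨ cong (_xor d) (Bool.xor-same a) ⟩
  d                ∎
  where open ≡-Reasoning

xor-transpose : ∀ a c s → (a xor c ≡ s) ⇔ (a ≡ s xor c)
xor-transpose a c s = mk⇔ (λ { refl → sym (xor-cancelʳ a) }) (λ { refl → xor-cancelʳ s })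
  where
  xor-cancelʳ : ∀ x → (x xor c) xor c ≡ x
  xor-cancelʳ x = trans (Bool.xor-assoc x c c) (trans (cong (x xor_) (Bool.xor-same c)) (Bool.xor-identityʳ x))

lookup-linked : ∀ {a r} {A : Set a} {R : A → A → Set r} {n} {xs : Vec A (suc n)} →
                Linked R xs → ∀ i → R (lookup xs (inject₁ i)) (lookup xs (suc i))
lookup-linked {xs = x ∷ y ∷ xs} (r ∷ rs) zero    = r
lookup-linked {xs = x ∷ y ∷ xs} (r ∷ rs) (suc i) = lookup-linked rs i

IsCompleteBipartite : (T : Graph) → (Fin (V T) → Bool) → Set
IsCompleteBipartite T side = ∀ x y → Adj T x y ⇔ (side x ≢ side y)

module _ {T : Graph} where

  Adj-sym : ∀ {x y} → Adj T x y → Adj T y x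
  Adj-sym {x} {y} xy = trans (Graph.sym T y x) xy

  Adj⇒≢ : ∀ {x y} → Adj T x y → x ≢ y
  Adj⇒≢ {x} xy refl with trans (sym xy) (irrefl T x)
  ... | ()

  cycle : ∀ {l} (xs : Vec (Fin (V T)) (3 + l)) → Unique xs → Linked (Adj T) xs →
          Adj T (lookup xs (fromℕ (2 + l))) (lookup xs zero) → Cycle T
  cycle {l} xs distinct path closing = record
    { l = l ; f = lookup xs ; inj = lookup-injective distinct _ _ ; step = lookup-linked path ; close = closing }

  triangle : ∀ {x y z} → Adj T x y → Adj T y z → Adj T z x → Cycle T
  triangle xy yz zx = cycle (_ ∷ _ ∷ _ ∷ [])
    ((Adj⇒≢ xy ∷ Adj⇒≢ (Adj-sym zx) ∷ []) ∷ (Adj⇒≢ yz ∷ []) ∷ [] ∷ [])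
    (xy ∷ yz ∷ [-]) zx

  Universal : Fin (V T) → Set
  Universal c = ∀ x → x ≢ c → Adj T c x

  module _ (acyclic : Acyclic T) where

    universal⇒completeBipartite : ∀ {c} → Universal c → IsCompleteBipartite T (λ x → isYes (x ≟ c))
    universal⇒completeBipartite {c} universal x y with x ≟ c | y ≟ c
    ... | yes refl | yes refl = mk⇔ (λ cc → contradiction refl (Adj⇒≢ cc)) (λ t≢t → contradiction refl t≢t)
    ... | yes refl | no y≢c   = mk⇔ (λ _ ()) (λ _ → universal y y≢c)
    ... | no x≢c   | yes refl = mk⇔ (λ _ ()) (λ _ → Adj-sym (universal x x≢c))
    ... | no x≢c   | no y≢c   =
      mk⇔ (λ xy → contradiction (triangle (universal x x≢c) xy (Adj-sym (universal y y≢c))) acyclic)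
          (λ f≢f → contradiction refl f≢f)

    module _ (diameter≤2 : DiameterAtMost2 T) where

      private
        adj? : ∀ x y → Dec (Adj T x y)
        adj? x y = adj T x y Bool.≟ true

      adjacent-to-edge : ∀ {a b x} → Adj T a b → x ≢ a → x ≢ b → Adj T a x ⊎ Adj T b x
      adjacent-to-edge {a} {b} {x} ab x≢a x≢b with adj? a x | adj? b x
      ... | yes ax | _      = inj₁ ax
      ... | no _   | yes bx = inj₂ bx
      ... | no ¬ax | no ¬bx =
        ⊥-elim (no-detours (diameter≤2 a x (≢-sym x≢a)) (diameter≤2 b x (≢-sym x≢b)))
        where
        no-detours : Adj T a x ⊎ ∃[ z ] (Adj T a z × Adj T z x) →
                     Adj T b x ⊎ ∃[ y ] (Adj T b y × Adj T y x) → ⊥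
        no-detours (inj₁ ax) _ = ¬ax ax
        no-detours _ (inj₁ bx) = ¬bx bx
        no-detours (inj₂ (z , az , zx)) (inj₂ (y , by , yx)) with y ≟ z
        ... | yes refl = acyclic (triangle ab by (Adj-sym az))
        ... | no y≢z   = acyclic (cycle (a ∷ z ∷ x ∷ y ∷ b ∷ [])
          ( (Adj⇒≢ az ∷ ≢-sym x≢a ∷ (λ { refl → ¬ax yx }) ∷ Adj⇒≢ ab ∷ [])
          ∷ (Adj⇒≢ zx ∷ ≢-sym y≢z ∷ (λ { refl → ¬bx zx }) ∷ [])
          ∷ (Adj⇒≢ (Adj-sym yx) ∷ x≢b ∷ [])
          ∷ (Adj⇒≢ (Adj-sym by) ∷ [])
          ∷ [] ∷ [])
          (az ∷ zx ∷ Adj-sym yx ∷ Adj-sym by ∷ [-]) (Adj-sym ab))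

      middle-universal : ∀ {z w x} → Adj T z w → Adj T w x → ¬ Adj T z x → x ≢ z → Universal w
      middle-universal {z} {w} {x} zw wx ¬zx x≢z y y≢w with y ≟ z | y ≟ x
      ... | yes refl | _        = Adj-sym zw
      ... | no _     | yes refl = wx
      ... | no y≢z   | no y≢x   with adjacent-to-edge zw y≢z y≢w | adjacent-to-edge wx y≢w y≢x
      ...   | inj₂ wy | _       = wy
      ...   | inj₁ _  | inj₁ wy = wy
      ...   | inj₁ zy | inj₂ xy = ⊥-elim (acyclic (cycle (z ∷ w ∷ x ∷ y ∷ [])
        ( (Adj⇒≢ zw ∷ ≢-sym x≢z ∷ Adj⇒≢ zy ∷ [])
        ∷ (Adj⇒≢ wx ∷ ≢-sym y≢w ∷ [])
        ∷ (Adj⇒≢ xy ∷ [])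
        ∷ [] ∷ [])
        (zw ∷ wx ∷ xy ∷ [-]) (Adj-sym zy)))

      universal-vertex : Fin (V T) → ∃[ c ] Universal c
      universal-vertex z with any? (λ x → ¬? (x ≟ z) ×-dec ¬? (adj? z x))
      ... | no ∄x = z , λ x x≢z → decidable-stable (adj? z x) (λ ¬zx → ∄x (x , x≢z , ¬zx))
      ... | yes (x , x≢z , ¬zx) with diameter≤2 z x (≢-sym x≢z)
      ...   | inj₁ zx             = contradiction zx ¬zx
      ...   | inj₂ (w , zw , wx)  = w , middle-universal zw wx ¬zx x≢z

tree-diameter≤2⇒completeBipartite : ∀ {T} → IsTree T → DiameterAtMost2 T →
                                    ∃[ side ] IsCompleteBipartite T side
tree-diameter≤2⇒completeBipartite (nonempty , _ , acyclic) diameter≤2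
  with universal-vertex acyclic diameter≤2 (fromℕ< nonempty)
... | c , universal = _ , universal⇒completeBipartite acyclic universal

colourCount≡fibreSize : ∀ G {k} (c : ComponentLabelling G k) col i b →
                        colourCount G c col i b ≡ fibreSize (label c) col i b
colourCount≡fibreSize G c col i b =
  trans (length-filter≡sumOver-𝟙 _ (allFin (V G)))
        (sumOver-tabulate (λ v → v) (λ v → 𝟙 ((label c v ≟ i) ×-dec (col v Bool.≟ b))))

partSize : ∀ {t} → (Fin t → Bool) → Bool → ℕ
partSize {t} side b = sumOver (allFin t) (λ x → 𝟙 (side x Bool.≟ b))

bipartiteHomCount : ℕ → ℕ → ℕ → ℕ → ℕ
bipartiteHomCount a b p q = a ^ p * b ^ q + b ^ p * a ^ q

module HomsIntoCompleteBipartite {G T : Graph} {k} (c : ComponentLabelling G k)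
  {col : Fin (V G) → Bool} (proper : ProperColouring G col)
  {side : Fin (V T) → Bool} (complete : IsCompleteBipartite T side) where

  Map : Set
  Map = Vec (Fin (V T)) (V G)

  parity : Map → Fin (V G) → Bool
  parity f v = side (lookup f v) xor col v

  parity-invariant : ∀ {f} → IsHom G T f → ∀ {u v} → Reachable G u v → parity f u ≡ parity f v
  parity-invariant hom ε = refl
  parity-invariant {f} hom (uw ◅ wv) =
    trans (xor-≢ (Equivalence.to (complete _ _) (hom _ _ uw)) (proper _ _ uw)) (parity-invariant {f} hom wv)

  representative : Fin k → Fin (V G)
  representative i = proj₁ (surj c i)

  componentParity : Map → Fin k → Bool
  componentParity f i = parity f (representative i)

  hasParity? : ∀ σ f v → Dec (parity f v ≡ lookup σ (label c v))
  hasParity? σ f v = parity f v Bool.≟ lookup σ (label c v)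

  HasParities : Vec Bool k → Map → Set
  HasParities σ f = ∀ v → parity f v ≡ lookup σ (label c v)

  hasParities⇔isHom×agree : ∀ σ f →
    HasParities σ f ⇔ (IsHom G T f × ∀ i → lookup σ i ≡ componentParity f i)
  hasParities⇔isHom×agree σ f = mk⇔ (λ has → hasParities⇒isHom has , hasParities⇒agree has)
                                    isHom×agree⇒hasParities
    where
    hasParities⇒isHom : HasParities σ f → IsHom G T f
    hasParities⇒isHom has u v uv = Equivalence.from (complete _ _) λ same →
      proper u v uv (xor-cancelˡ (side (lookup f u)) (begin
        side (lookup f u) xor col u  ≡⟨ has u ⟩
        lookup σ (label c u)         ≡⟨ cong (lookup σ) (proj₂ (sameComp c u v) (uv ◅ ε)) ⟩
        lookup σ (label c v)         ≡⟨ has v ⟨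
        side (lookup f v) xor col v  ≡⟨ cong (_xor col v) same ⟨
        side (lookup f u) xor col v  ∎))
      where open ≡-Reasoning
    hasParities⇒agree : HasParities σ f → ∀ i → lookup σ i ≡ componentParity f i
    hasParities⇒agree has i = trans (cong (lookup σ) (sym (proj₂ (surj c i)))) (sym (has (representative i)))
    isHom×agree⇒hasParities : IsHom G T f × (∀ i → lookup σ i ≡ componentParity f i) → HasParities σ f
    isHom×agree⇒hasParities (hom , agree) v =
      trans (sym (parity-invariant {f} hom (proj₁ (sameComp c _ v) (proj₂ (surj c (label c v))))))
            (sym (agree (label c v)))

  parityVectors : List (Vec Bool k)
  parityVectors = vecsOver bools k

  𝟙-isHom≡sumOver-parityVectors : ∀ f →
    𝟙 (isHom? G T f) ≡ sumOver parityVectors (λ σ → ∏ (λ v → 𝟙 (hasParity? σ f v)))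
  𝟙-isHom≡sumOver-parityVectors f = sym (begin
    sumOver parityVectors (λ σ → ∏ (λ v → 𝟙 (hasParity? σ f v)))
      ≡⟨ sumOver-cong parityVectors (λ σ → ∏-𝟙 (hasParity? σ f) (all? (hasParity? σ f))) ⟩
    sumOver parityVectors (λ σ → 𝟙 (all? (hasParity? σ f)))
      ≡⟨ sumOver-cong parityVectors (λ σ → 𝟙-cong (all? (hasParity? σ f)) (isHom? G T f ×-dec agree? σ)
                                                 (hasParities⇔isHom×agree σ f)) ⟩
    sumOver parityVectors (λ σ → 𝟙 (isHom? G T f ×-dec agree? σ))
      ≡⟨ sumOver-cong parityVectors (λ σ → 𝟙-× (isHom? G T f) (agree? σ)) ⟩
    sumOver parityVectors (λ σ → 𝟙 (isHom? G T f) * 𝟙 (agree? σ))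
      ≡⟨ *-distribˡ-sumOver (𝟙 (isHom? G T f)) parityVectors (λ σ → 𝟙 (agree? σ)) ⟨
    𝟙 (isHom? G T f) * sumOver parityVectors (λ σ → 𝟙 (agree? σ))
      ≡⟨ cong (𝟙 (isHom? G T f) *_) (sumOver-vecsOver-bools-𝟙-agree (componentParity f)) ⟩
    𝟙 (isHom? G T f) * 1
      ≡⟨ *-identityʳ _ ⟩
    𝟙 (isHom? G T f) ∎)
    where
    open ≡-Reasoning
    agree? : ∀ σ → Dec (∀ i → lookup σ i ≡ componentParity f i)
    agree? σ = all? (λ i → lookup σ i Bool.≟ componentParity f i)

  homCount≡∏bipartiteHomCount : homCount G T ≡
    ∏ (λ i → bipartiteHomCount (partSize side true) (partSize side false)
                               (colourCount G c col i false) (colourCount G c col i true))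
  homCount≡∏bipartiteHomCount = begin
    length (filter (isHom? G T) (allVecs (V G) (V T)))
      ≡⟨ length-filter≡sumOver-𝟙 (isHom? G T) (allVecs (V G) (V T)) ⟩
    sumOver (allVecs (V G) (V T)) (λ f → 𝟙 (isHom? G T f))
      ≡⟨ cong (λ fs → sumOver fs (λ f → 𝟙 (isHom? G T f))) (allVecs≡vecsOver-allFin (V G) (V T)) ⟩
    sumOver maps (λ f → 𝟙 (isHom? G T f))
      ≡⟨ sumOver-cong maps 𝟙-isHom≡sumOver-parityVectors ⟩
    sumOver maps (λ f → sumOver parityVectors (λ σ → ∏ (λ v → 𝟙 (hasParity? σ f v))))
      ≡⟨ sumOver-comm maps parityVectors _ ⟩
    sumOver parityVectors (λ σ → sumOver maps (λ f → ∏ (λ v → 𝟙 (hasParity? σ f v))))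
      ≡⟨ sumOver-cong parityVectors (λ σ → sumOver-vecsOver-∏ (allFin (V T)) (V G) (image-side σ)) ⟩
    sumOver parityVectors (λ σ → ∏ (λ v → sumOver (allFin (V T)) (image-side σ v)))
      ≡⟨ sumOver-cong parityVectors (λ σ → ∏.sum-cong-≗ (λ v → image-partSize σ v)) ⟩
    sumOver parityVectors (λ σ → ∏ (λ v → partSize side (lookup σ (label c v) xor col v)))
      ≡⟨ sumOver-cong parityVectors (λ σ → ∏-group (λ i s → partSize side (lookup σ i xor s)) (label c) col) ⟩
    sumOver parityVectors (λ σ → ∏ (λ i → weight i (lookup σ i)))
      ≡⟨ sumOver-vecsOver-∏ bools k weight ⟩
    ∏ (λ i → weight i true + (weight i false + 0))
      ≡⟨ ∏.sum-cong-≗ (λ i → cong (weight i true +_) (+-identityʳ _)) ⟩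
    ∏ (λ i → bipartiteHomCount (partSize side true) (partSize side false)
                               (fibreSize (label c) col i false) (fibreSize (label c) col i true))
      ≡⟨ ∏.sum-cong-≗ (λ i → sym (cong₂ (bipartiteHomCount _ _) (colourCount≡fibreSize G c col i false)
                                                               (colourCount≡fibreSize G c col i true))) ⟩
    ∏ (λ i → bipartiteHomCount (partSize side true) (partSize side false)
                               (colourCount G c col i false) (colourCount G c col i true)) ∎
    where
    open ≡-Reasoning
    maps : List Map
    maps = vecsOver (allFin (V T)) (V G)
    image-side : Vec Bool k → Fin (V G) → Fin (V T) → ℕ
    image-side σ v x = 𝟙 (side x xor col v Bool.≟ lookup σ (label c v))
    image-partSize : ∀ σ v →
      sumOver (allFin (V T)) (image-side σ v) ≡ partSize side (lookup σ (label c v) xor col v)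
    image-partSize σ v = sumOver-cong (allFin (V T)) (λ x →
      𝟙-cong (side x xor col v Bool.≟ lookup σ (label c v)) (side x Bool.≟ lookup σ (label c v) xor col v)
             (xor-transpose (side x) (col v) (lookup σ (label c v))))
    weight : Fin k → Bool → ℕ
    weight i s = partSize side (s xor false) ^ fibreSize (label c) col i false
               * partSize side (s xor true) ^ fibreSize (label c) col i true

ProperColouring-patch : ∀ G {k} (c : ComponentLabelling G k) (cols : Fin k → Fin (V G) → Bool) →
  (∀ i → ProperColouring G (cols i)) → ProperColouring G (λ v → cols (label c v) v)
ProperColouring-patch G c cols proper u v uv =
  subst (λ j → cols (label c u) u ≢ cols j v) (proj₂ (sameComp c u v) (uv ◅ ε)) (proper (label c u) u v uv)

colourCount-cong : ∀ G {k} (c : ComponentLabelling G k) {col col′ : Fin (V G) → Bool} i b →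
  (∀ v → label c v ≡ i → col v ≡ col′ v) → colourCount G c col i b ≡ colourCount G c col′ i b
colourCount-cong G c {col} {col′} i b agree = cong length (filter-≐
  (λ v → (label c v ≟ i) ×-dec (col v Bool.≟ b)) (λ v → (label c v ≟ i) ×-dec (col′ v Bool.≟ b))
  ((λ {v} (l , e) → l , trans (sym (agree v l)) e) , (λ {v} (l , e) → l , trans (agree v l) e))
  (allFin (V G)))

bipartiteHomCount-unordered : ∀ a b {p q m n} → (p ≡ m × q ≡ n) ⊎ (p ≡ n × q ≡ m) →
  bipartiteHomCount a b p q ≡ bipartiteHomCount a b m n
bipartiteHomCount-unordered a b (inj₁ (refl , refl)) = refl
bipartiteHomCount-unordered a b {p} {q} (inj₂ (refl , refl)) =
  trans (+-comm (a ^ p * b ^ q) (b ^ p * a ^ q)) (cong₂ _+_ (*-comm (b ^ p) (a ^ q)) (*-comm (a ^ p) (b ^ q)))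

homCount≡∏sizeParams : ∀ G T {k} (c : ComponentLabelling G k) (m n : Fin k → ℕ) →
  (∀ i → HasSizeParam G c i (m i) (n i)) → ∀ {side} → IsCompleteBipartite T side →
  homCount G T ≡ ∏ (λ i → bipartiteHomCount (partSize side true) (partSize side false) (m i) (n i))
homCount≡∏sizeParams G T {k} c m n sizes {side} complete =
  trans (HomsIntoCompleteBipartite.homCount≡∏bipartiteHomCount {T = T} c proper complete)
        (∏.sum-cong-≗ component)
  where
  colouring : Fin k → Fin (V G) → Bool
  colouring i = proj₁ (proj₂ (sizes i))
  col : Fin (V G) → Bool
  col v = colouring (label c v) v
  proper : ProperColouring G col
  proper = ProperColouring-patch G c colouring (λ i → proj₁ (proj₂ (proj₂ (sizes i))))
  component : ∀ i → bipartiteHomCount (partSize side true) (partSize side false)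
                                      (colourCount G c col i false) (colourCount G c col i true)
                  ≡ bipartiteHomCount (partSize side true) (partSize side false) (m i) (n i)
  component i = trans (cong₂ (bipartiteHomCount _ _) (recolour false) (recolour true))
                      (bipartiteHomCount-unordered _ _ (proj₂ (proj₂ (proj₂ (sizes i)))))
    where
    recolour : ∀ b → colourCount G c col i b ≡ colourCount G c (colouring i) i b
    recolour b = colourCount-cong G c i b (λ v l → cong (λ j → colouring j v) l)

corollary8 : (G H : Graph) → Bipartite G → Bipartite H →
    {k l : ℕ} (cG : ComponentLabelling G k) (cH : ComponentLabelling H l) →
    ComponentsNontrivial G cG → ComponentsNontrivial H cH →
    (β : Fin k ↔ Fin l) →
    (∀ (i : Fin k) → ∃[ m ] ∃[ n ]
        (HasSizeParam G cG i m n × HasSizeParam H cH (Inverse.to β i) m n)) →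
    (T : Graph) → IsTree T → DiameterAtMost2 T →
    homCount G T ≡ homCount H T
corollary8 G H _ _ {k} cG cH _ _ β sizes T tree diameter≤2
  with tree-diameter≤2⇒completeBipartite tree diameter≤2
... | side , complete = begin
  homCount G T
    ≡⟨ homCount≡∏sizeParams G T cG m n sizesG complete ⟩
  ∏ (λ i → bipartiteHomCount a b (m i) (n i))
    ≡⟨ ∏.∑-permute (λ i → bipartiteHomCount a b (m i) (n i)) (Permutation.flip β) ⟩
  ∏ (λ j → bipartiteHomCount a b (m (Inverse.from β j)) (n (Inverse.from β j)))
    ≡⟨ homCount≡∏sizeParams H T cH (m ∘ Inverse.from β) (n ∘ Inverse.from β) sizesH complete ⟨
  homCount H T ∎
  where
  open ≡-Reasoning
  a b : ℕ
  a = partSize side true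
  b = partSize side false
  m n : Fin k → ℕ
  m i = proj₁ (sizes i)
  n i = proj₁ (proj₂ (sizes i))
  sizesG : ∀ i → HasSizeParam G cG i (m i) (n i)
  sizesG i = proj₁ (proj₂ (proj₂ (sizes i)))
  sizesH : ∀ j → HasSizeParam H cH j (m (Inverse.from β j)) (n (Inverse.from β j))
  sizesH j = subst (λ j′ → HasSizeParam H cH j′ _ _) (Permutation.inverseʳ β)
                   (proj₂ (proj₂ (proj₂ (sizes (Inverse.from β j)))))
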